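{- Let $1 \leq t \leq r$ and let $\mathcal{A}$ be a $t$-intersecting subfamily of a $(\leq r)$-family $\mathcal{F}$ with $l(\mathcal{F},t) \geq c(r,r,t)\, l(\mathcal{F},t+1)$. Then $|\mathcal{A}| \leq l(\mathcal{F},t)$, and equality holds if and only if $\mathcal{A} \in {\rm L}(\mathcal{F},t)$.
   Context: All sets and families are finite. A set $A$ $t$-intersects $B$ if $|A\cap B|\geq t$; a family is $t$-intersecting if every two of its sets $t$-intersect. For a family $\mathcal{F}$ and a set $T$, $\mathcal{F}(T)=\{F\in\mathcal{F}: T\subseteq F\}$, a $t$-star if $|T|=t$. $l(\mathcal{F},t)$ is the size of a largest $t$-star of $\mathcal{F}$ and ${\rm L}(\mathcal{F},t)$ is the set of largest $t$-stars of $\mathcal{F}$. A $(\leq r)$-family is a family each of whose sets has at most $r$ elements. For $t\leq r$, $c(r,r,t)=r\binom{r}{t}+1$. -}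

module Defs where

open import Data.Nat using (ℕ; zero; suc; _+_; _*_; _≤_; _⊔_)
import Data.Nat
open import Data.Nat.Combinatorics using (_C_)
open import Data.Bool using (Bool; true; false; _∧_; T)
open import Data.Bool.Properties using (T?)
open import Data.List using (List; []; _∷_; _++_; map; filter; length; foldr)
open import Data.Vec using (_∷_; [])
open import Data.Fin.Subset using (Subset; inside; outside; _⊆_; _∩_; ∣_∣)
open import Data.Fin.Subset.Properties using (_⊆?_)
open import Data.Product using (Σ; _×_)
open import Relation.Nullary using (does)
open import Relation.Binary.PropositionalEquality using (_≡_)

Family : ℕ → Set
Family n = Subset n → Bool

-- All 2^n subsets of Fin n (each exactly once).
allSubsets : (n : ℕ) → List (Subset n)
allSubsets zero    = [] ∷ []
allSubsets (suc n) = map (outside ∷_) (allSubsets n) ++ map (inside ∷_) (allSubsets n)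

_∈ᶠ_ : {n : ℕ} → Subset n → Family n → Set
S ∈ᶠ 𝒜 = 𝒜 S ≡ true

_⊆ᶠ_ : {n : ℕ} → Family n → Family n → Set
𝒜 ⊆ᶠ ℱ = ∀ S → S ∈ᶠ 𝒜 → S ∈ᶠ ℱ

size : {n : ℕ} → Family n → ℕ
size {n} 𝒜 = length (filter (λ S → T? (𝒜 S)) (allSubsets n))

IsLeFamily : {n : ℕ} → ℕ → Family n → Set
IsLeFamily r ℱ = ∀ S → S ∈ᶠ ℱ → ∣ S ∣ ≤ r

-- t-intersecting family (every two sets, not necessarily distinct)
IsIntersecting : {n : ℕ} → ℕ → Family n → Set
IsIntersecting t 𝒜 = ∀ A B → A ∈ᶠ 𝒜 → B ∈ᶠ 𝒜 → t ≤ ∣ A ∩ B ∣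

star : {n : ℕ} → Family n → Subset n → Family n
star ℱ T₀ S = ℱ S ∧ does (T₀ ⊆? S)

tSubsets : (n t : ℕ) → List (Subset n)
tSubsets n t = filter (λ S → ∣ S ∣ Data.Nat.≟ t) (allSubsets n)

l : {n : ℕ} → Family n → ℕ → ℕ
l {n} ℱ t = foldr _⊔_ 0 (map (λ T₀ → size (star ℱ T₀)) (tSubsets n t))

InL : {n : ℕ} → Family n → Family n → ℕ → Set
InL {n} 𝒜 ℱ t =
  Σ (Subset n) λ T₀ → (∣ T₀ ∣ ≡ t) × ((∀ S → 𝒜 S ≡ star ℱ T₀ S) × (size (star ℱ T₀) ≡ l ℱ t))

c : ℕ → ℕ → ℕ → ℕ
c r _ t = r * (r C t) + 1

-- If 𝒜 lies inside a t-star ℱ(T), then |𝒜| ≤ |ℱ(T)| ≤ l(ℱ,t), with equality only when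
-- 𝒜 = ℱ(T) is a largest t-star. Otherwise no t-set lies in all members of 𝒜, and we show
-- |𝒜| < l(ℱ,t). Fix A₁ ∈ 𝒜. Every member of 𝒜 meets A₁ in at least t points, so 𝒜 is covered
-- by the stars 𝒜(T) of the binom(|A₁|,t) t-subsets T of A₁. For such T pick B ∈ 𝒜 with T ⊈ B.
-- A member S ∈ 𝒜(T) has |S ∩ B| ≥ t > |T ∩ B|, so S contains some x ∈ B ∖ T and lies in the
-- (t+1)-star ℱ(T ∪ {x}). Thus |𝒜(T)| ≤ r l(ℱ,t+1) and
-- 0 < |𝒜| ≤ r binom(r,t) l(ℱ,t+1) < c(r,r,t) l(ℱ,t+1) ≤ l(ℱ,t).
module Submission where

open import Defs
open import Data.Bool using (Bool; true; false; _∨_; T)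
open import Data.Bool.Properties using (T?; T-≡)
import Data.Bool as Bool
open import Data.Empty using (⊥-elim)
open import Data.Fin using (Fin; zero; suc)
open import Data.Fin.Properties using (any?)
open import Data.Fin.Subset
  using (Subset; inside; outside; _⊆_; _∩_; _∪_; ⁅_⁆; ∣_∣; ⊤; ⊥; _∈_; _∉_)
open import Data.Fin.Subset.Properties
  using (_∈?_; _⊆?_; ⊥⊆; drop-∷-⊆; ∣⊥∣≡0; ∣⊤∣≡n; out⊆; s⊆s; x∈p∩q⁺; x∈p∩q⁻; x∈p∪q⁻; x∈⁅y⁆⇒x≡y;
         ∪-identityʳ; p⊆q⇒∣p∣≤∣q∣; p⊂q⇒∣p∣<∣q∣)
open import Data.List using (List; []; _∷_; _++_; map; filter; length; foldr)
open import Data.Bool.ListAction using (any)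
open import Data.List.Membership.Propositional using () renaming (_∈_ to _∈ˡ_)
open import Data.List.Membership.Propositional.Properties
  using (∈-filter⁺; ∈-filter⁻; ∈-map⁺; ∈-++⁺ˡ; ∈-++⁺ʳ; ∈-length)
open import Data.List.Properties using (length-map; length-++; length-filter; filter-none)
open import Data.List.Relation.Binary.Equality.Propositional using (≋⇒≡)
open import Data.List.Relation.Binary.Sublist.Propositional using (⊆-refl) renaming (_⊆_ to _⊑_)
open import Data.List.Relation.Binary.Sublist.Propositional.Properties
  using (filter⁺; length-mono-≤; to-≋)
open import Data.List.Relation.Unary.All as All using (All; []; _∷_)
open import Data.List.Relation.Unary.All.Properties using (map⁺; ++⁺)
open import Data.List.Relation.Unary.Any using (here; there; satisfied)
open import Data.Vec using ([]; _∷_; here; there)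
open import Data.Nat
  using (ℕ; zero; suc; _+_; _*_; _≤_; _<_; _≤′_; ≤′-refl; ≤′-step; _⊔_; _≟_; z≤n; s≤s; z<s)
open import Data.Nat.Combinatorics using (_C_; nCk+nC[k+1]≡[n+1]C[k+1])
open import Data.Nat.Properties
open import Data.Product using (∃; _×_; _,_; proj₁; proj₂)
open import Data.Sum using (_⊎_; inj₁; inj₂)
open import Function using (_∘_)
open import Function.Bundles using (_⇔_; mk⇔; Equivalence)
open import Relation.Binary.PropositionalEquality
open import Relation.Nullary using (¬_; contradiction; Dec; yes; no; ¬?; _×-dec_)
open import Relation.Nullary.Decidable using (decidable-stable)
open import Relation.Unary using (Decidable)

private
  variable
    n : ℕ

count : {A : Set} → (A → Bool) → List A → ℕ
count f xs = length (filter (λ x → T? (f x)) xs)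

module _ {A : Set} {f g : A → Bool} (f⇒g : ∀ x → f x ≡ true → g x ≡ true) (xs : List A) where

  private
    T-f⇒T-g : ∀ {x y} → x ≡ y → T (f x) → T (g y)
    T-f⇒T-g {x} refl = Equivalence.from T-≡ ∘ f⇒g x ∘ Equivalence.to T-≡

    filter-f⊆filter-g : filter (λ x → T? (f x)) xs ⊑ filter (λ x → T? (g x)) xs
    filter-f⊆filter-g = filter⁺ (λ x → T? (f x)) (λ x → T? (g x)) T-f⇒T-g (⊆-refl {x = xs})

  count-mono : count f xs ≤ count g xs
  count-mono = length-mono-≤ filter-f⊆filter-g

  count-mono-≥⇒⇐ : count g xs ≤ count f xs → ∀ {x} → x ∈ˡ xs → g x ≡ true → f x ≡ true
  count-mono-≥⇒⇐ g≤f x∈xs gx =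
    Equivalence.to T-≡ (proj₂ (∈-filter⁻ (λ x → T? (f x)) {xs = xs} x∈filter-f))
    where
    same-filter : filter (λ x → T? (f x)) xs ≡ filter (λ x → T? (g x)) xs
    same-filter = ≋⇒≡ (to-≋ (≤-antisym count-mono g≤f) filter-f⊆filter-g)
    x∈filter-f = subst (_ ∈ˡ_) (sym same-filter)
                       (∈-filter⁺ (λ x → T? (g x)) x∈xs (Equivalence.from T-≡ gx))

count-∨ : {A : Set} (f g : A → Bool) (xs : List A) →
          count (λ x → f x ∨ g x) xs ≤ count f xs + count g xs
count-∨ f g [] = z≤n
count-∨ f g (x ∷ xs) with f x | g x
... | true  | true  = s≤s (≤-trans (count-∨ f g xs) (+-monoʳ-≤ (count f xs) (n≤1+n _)))
... | true  | false = s≤s (count-∨ f g xs)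
... | false | true  = ≤-trans (s≤s (count-∨ f g xs)) (≤-reflexive (sym (+-suc _ _)))
... | false | false = count-∨ f g xs

≤-foldr-⊔ : ∀ {m ms} → m ∈ˡ ms → m ≤ foldr _⊔_ 0 ms
≤-foldr-⊔ {ms = m ∷ _}  (here refl) = m≤m⊔n m _
≤-foldr-⊔ {ms = k ∷ ms} (there m∈)  = ≤-trans (≤-foldr-⊔ m∈) (m≤n⊔m k _)

0<m≤k*l⇒m<[k+1]*l : ∀ {m} k l → 0 < m → m ≤ k * l → m < (k + 1) * l
0<m≤k*l⇒m<[k+1]*l k zero 0<m m≤k*0 =
  contradiction (≤-trans 0<m (≤-trans m≤k*0 (≤-reflexive (*-zeroʳ k)))) λ ()
0<m≤k*l⇒m<[k+1]*l {m} k l@(suc _) _ m≤k*l = begin-strict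
  m             ≤⟨ m≤k*l ⟩
  k * l         <⟨ m<m+n (k * l) z<s ⟩
  k * l + l     ≡⟨ cong (k * l +_) (sym (*-identityˡ l)) ⟩
  k * l + 1 * l ≡⟨ *-distribʳ-+ l k 1 ⟨
  (k + 1) * l   ∎
  where open ≤-Reasoning

C-mono-suc : ∀ m k → m C k ≤ suc m C k
C-mono-suc m zero    = ≤-refl
C-mono-suc m (suc k) =
  subst (m C suc k ≤_) (nCk+nC[k+1]≡[n+1]C[k+1] m k) (m≤n+m (m C suc k) (m C k))

C-monoˡ : ∀ {m m′} k → m ≤ m′ → m C k ≤ m′ C k
C-monoˡ k m≤m′ = go (≤⇒≤′ m≤m′)
  where
  go : ∀ {m m′} → m ≤′ m′ → m C k ≤ m′ C k
  go ≤′-refl         = ≤-refl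
  go (≤′-step m≤′m′) = ≤-trans (go m≤′m′) (C-mono-suc _ k)

∈-allSubsets : (S : Subset n) → S ∈ˡ allSubsets n
∈-allSubsets []            = here refl
∈-allSubsets (outside ∷ S) = ∈-++⁺ˡ (∈-map⁺ (outside ∷_) (∈-allSubsets S))
∈-allSubsets (inside ∷ S)  =
  ∈-++⁺ʳ (map (outside ∷_) (allSubsets _)) (∈-map⁺ (inside ∷_) (∈-allSubsets S))

searchˢ : {P : Subset n → Set} → Decidable P → (∀ S → ¬ P S) ⊎ ∃ P
searchˢ {n} P? with All.search P? (allSubsets n)
... | inj₁ none = inj₁ (λ S → All.lookup none (∈-allSubsets S))
... | inj₂ some = inj₂ (satisfied some)

elements : Subset n → List (Fin n)
elements []            = []
elements (inside ∷ p)  = zero ∷ map suc (elements p)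
elements (outside ∷ p) = map suc (elements p)

∈-elements : ∀ {x} (p : Subset n) → x ∈ p → x ∈ˡ elements p
∈-elements (inside ∷ p)  here       = here refl
∈-elements (inside ∷ p)  (there x∈) = there (∈-map⁺ suc (∈-elements p x∈))
∈-elements (outside ∷ p) (there x∈) = ∈-map⁺ suc (∈-elements p x∈)

length-elements : (p : Subset n) → length (elements p) ≡ ∣ p ∣
length-elements []            = refl
length-elements (inside ∷ p)  = cong suc (trans (length-map suc (elements p)) (length-elements p))
length-elements (outside ∷ p) = trans (length-map suc (elements p)) (length-elements p)

subsetsOfSize : Subset n → ℕ → List (Subset n)
subsetsOfSize []            zero    = [] ∷ []
subsetsOfSize []            (suc t) = []
subsetsOfSize (outside ∷ p) t       = map (outside ∷_) (subsetsOfSize p t)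
subsetsOfSize (inside ∷ p)  zero    = map (outside ∷_) (subsetsOfSize p zero)
subsetsOfSize (inside ∷ p)  (suc t) =
  map (outside ∷_) (subsetsOfSize p (suc t)) ++ map (inside ∷_) (subsetsOfSize p t)

∈-subsetsOfSize : ∀ {q p : Subset n} {t} → q ⊆ p → ∣ q ∣ ≡ t → q ∈ˡ subsetsOfSize p t
∈-subsetsOfSize {q = []}          {[]}          {zero}  _   _  = here refl
∈-subsetsOfSize {q = outside ∷ q} {outside ∷ p}         q⊆p e  =
  ∈-map⁺ (outside ∷_) (∈-subsetsOfSize (drop-∷-⊆ q⊆p) e)
∈-subsetsOfSize {q = inside ∷ q}  {outside ∷ p}         q⊆p _  with q⊆p here
... | ()
∈-subsetsOfSize {q = outside ∷ q} {inside ∷ p}  {zero}  q⊆p e  =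
  ∈-map⁺ (outside ∷_) (∈-subsetsOfSize (drop-∷-⊆ q⊆p) e)
∈-subsetsOfSize {q = outside ∷ q} {inside ∷ p}  {suc t} q⊆p e  =
  ∈-++⁺ˡ (∈-map⁺ (outside ∷_) (∈-subsetsOfSize (drop-∷-⊆ q⊆p) e))
∈-subsetsOfSize {q = inside ∷ q}  {inside ∷ p}  {suc t} q⊆p e  =
  ∈-++⁺ʳ (map (outside ∷_) (subsetsOfSize p (suc t)))
         (∈-map⁺ (inside ∷_) (∈-subsetsOfSize (drop-∷-⊆ q⊆p) (suc-injective e)))

∣∣≡-subsetsOfSize : ∀ (p : Subset n) t → All (λ q → ∣ q ∣ ≡ t) (subsetsOfSize p t)
∣∣≡-subsetsOfSize []            zero    = refl ∷ []
∣∣≡-subsetsOfSize []            (suc t) = []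
∣∣≡-subsetsOfSize (outside ∷ p) t       = map⁺ (∣∣≡-subsetsOfSize p t)
∣∣≡-subsetsOfSize (inside ∷ p)  zero    = map⁺ (∣∣≡-subsetsOfSize p zero)
∣∣≡-subsetsOfSize (inside ∷ p)  (suc t) =
  ++⁺ (map⁺ (∣∣≡-subsetsOfSize p (suc t))) (map⁺ (All.map (cong suc) (∣∣≡-subsetsOfSize p t)))

length-subsetsOfSize : ∀ (p : Subset n) t → length (subsetsOfSize p t) ≡ ∣ p ∣ C t
length-subsetsOfSize []            zero    = refl
length-subsetsOfSize []            (suc t) = refl
length-subsetsOfSize (outside ∷ p) t       =
  trans (length-map (outside ∷_) (subsetsOfSize p t)) (length-subsetsOfSize p t)
length-subsetsOfSize (inside ∷ p)  zero    =
  trans (length-map (outside ∷_) (subsetsOfSize p zero)) (length-subsetsOfSize p zero)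
length-subsetsOfSize (inside ∷ p)  (suc t) = begin
  length (map (outside ∷_) (subsetsOfSize p (suc t)) ++ map (inside ∷_) (subsetsOfSize p t))
    ≡⟨ length-++ (map (outside ∷_) (subsetsOfSize p (suc t))) ⟩
  length (map (outside ∷_) (subsetsOfSize p (suc t))) + length (map (inside ∷_) (subsetsOfSize p t))
    ≡⟨ cong₂ _+_ (length-map (outside ∷_) (subsetsOfSize p (suc t)))
                 (length-map (inside ∷_) (subsetsOfSize p t)) ⟩
  length (subsetsOfSize p (suc t)) + length (subsetsOfSize p t)
    ≡⟨ cong₂ _+_ (length-subsetsOfSize p (suc t)) (length-subsetsOfSize p t) ⟩
  ∣ p ∣ C suc t + ∣ p ∣ C t
    ≡⟨ +-comm (∣ p ∣ C suc t) (∣ p ∣ C t) ⟩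
  ∣ p ∣ C t + ∣ p ∣ C suc t
    ≡⟨ nCk+nC[k+1]≡[n+1]C[k+1] ∣ p ∣ t ⟩
  suc ∣ p ∣ C suc t ∎
  where open ≡-Reasoning

∃-subsetOfSize : ∀ (p : Subset n) t → t ≤ ∣ p ∣ → ∃ λ q → q ⊆ p × ∣ q ∣ ≡ t
∃-subsetOfSize {n} p         zero    _         = ⊥ , ⊥⊆ , ∣⊥∣≡0 n
∃-subsetOfSize (outside ∷ p) (suc t) t<∣p∣ with ∃-subsetOfSize p (suc t) t<∣p∣
... | q , q⊆p , ∣q∣≡t = outside ∷ q , out⊆ q⊆p , ∣q∣≡t
∃-subsetOfSize (inside ∷ p)  (suc t) (s≤s t≤∣p∣) with ∃-subsetOfSize p t t≤∣p∣
... | q , q⊆p , ∣q∣≡t = inside ∷ q , s⊆s q⊆p , cong suc ∣q∣≡t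

∣p∪⁅x⁆∣≡1+∣p∣ : ∀ {x} (p : Subset n) → x ∉ p → ∣ p ∪ ⁅ x ⁆ ∣ ≡ suc ∣ p ∣
∣p∪⁅x⁆∣≡1+∣p∣ {x = zero}  (outside ∷ p) _   = cong (suc ∘ ∣_∣) (∪-identityʳ p)
∣p∪⁅x⁆∣≡1+∣p∣ {x = zero}  (inside ∷ p)  x∉p = contradiction here x∉p
∣p∪⁅x⁆∣≡1+∣p∣ {x = suc x} (outside ∷ p) x∉p = ∣p∪⁅x⁆∣≡1+∣p∣ p (x∉p ∘ there)
∣p∪⁅x⁆∣≡1+∣p∣ {x = suc x} (inside ∷ p)  x∉p = cong suc (∣p∪⁅x⁆∣≡1+∣p∣ p (x∉p ∘ there))

p∪⁅x⁆⊆q : ∀ {x} {p q : Subset n} → p ⊆ q → x ∈ q → p ∪ ⁅ x ⁆ ⊆ q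
p∪⁅x⁆⊆q {x = x} {p} p⊆q x∈q y∈ with x∈p∪q⁻ p ⁅ x ⁆ y∈
... | inj₁ y∈p    = p⊆q y∈p
... | inj₂ y∈⁅x⁆ = subst (_∈ _) (sym (x∈⁅y⁆⇒x≡y x y∈⁅x⁆)) x∈q

p⊈q⇒∃∈∉ : {p q : Subset n} → ¬ p ⊆ q → ∃ λ x → x ∈ p × x ∉ q
p⊈q⇒∃∈∉ {p = p} {q} p⊈q with any? (λ x → (x ∈? p) ×-dec ¬? (x ∈? q))
... | yes witness = witness
... | no  none    =
  contradiction (λ {x} x∈p → decidable-stable (x ∈? q) (λ x∉q → none (x , x∈p , x∉q))) p⊈q

p⊈q⇒∣p∩q∣<∣p∣ : {p q : Subset n} → ¬ p ⊆ q → ∣ p ∩ q ∣ < ∣ p ∣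
p⊈q⇒∣p∩q∣<∣p∣ {p = p} {q} p⊈q with p⊈q⇒∃∈∉ p⊈q
... | x , x∈p , x∉q = p⊂q⇒∣p∣<∣q∣ ((proj₁ ∘ x∈p∩q⁻ p q) , x , x∈p , (x∉q ∘ proj₂ ∘ x∈p∩q⁻ p q))

size-mono : {𝒜 ℬ : Family n} → 𝒜 ⊆ᶠ ℬ → size 𝒜 ≤ size ℬ
size-mono {n} 𝒜⊆ℬ = count-mono 𝒜⊆ℬ (allSubsets n)

size-cong : {𝒜 ℬ : Family n} → (∀ S → 𝒜 S ≡ ℬ S) → size 𝒜 ≡ size ℬ
size-cong 𝒜≗ℬ = ≤-antisym (size-mono (λ S → trans (sym (𝒜≗ℬ S)))) (size-mono (λ S → trans (𝒜≗ℬ S)))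

size-pos : (𝒜 : Family n) (S : Subset n) → S ∈ᶠ 𝒜 → 0 < size 𝒜
size-pos 𝒜 S S∈𝒜 = ∈-length (∈-filter⁺ (λ S → T? (𝒜 S)) (∈-allSubsets S) (Equivalence.from T-≡ S∈𝒜))

⊆ᶠ∧size≥⇒≗ : {𝒜 ℬ : Family n} → 𝒜 ⊆ᶠ ℬ → size ℬ ≤ size 𝒜 → ∀ S → 𝒜 S ≡ ℬ S
⊆ᶠ∧size≥⇒≗ {n} {𝒜} {ℬ} 𝒜⊆ℬ ℬ≤𝒜 S with 𝒜 S in 𝒜S | ℬ S in ℬS
... | true  | true  = refl
... | false | false = refl
... | true  | false = trans (sym (𝒜⊆ℬ S 𝒜S)) ℬS
... | false | true  = trans (sym 𝒜S) (count-mono-≥⇒⇐ 𝒜⊆ℬ (allSubsets n) ℬ≤𝒜 (∈-allSubsets S) ℬS)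

⋃ᶠ : {I : Set} → List I → (I → Family n) → Family n
⋃ᶠ is 𝒢 S = any (λ i → 𝒢 i S) is

∈-⋃ᶠ : {I : Set} {i : I} {is : List I} (𝒢 : I → Family n) {S : Subset n} →
       i ∈ˡ is → S ∈ᶠ 𝒢 i → S ∈ᶠ ⋃ᶠ is 𝒢
∈-⋃ᶠ 𝒢 (here refl) S∈𝒢ᵢ rewrite S∈𝒢ᵢ = refl
∈-⋃ᶠ {is = j ∷ _} 𝒢 {S} (there i∈is) S∈𝒢ᵢ with 𝒢 j S
... | true  = refl
... | false = ∈-⋃ᶠ 𝒢 i∈is S∈𝒢ᵢ

size-⋃ᶠ : {I : Set} (is : List I) (𝒢 : I → Family n) {k : ℕ} →
          (∀ i → i ∈ˡ is → size (𝒢 i) ≤ k) → size (⋃ᶠ is 𝒢) ≤ length is * k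
size-⋃ᶠ {n} [] 𝒢 _ =
  ≤-reflexive (cong length (filter-none (λ _ → T? false) (All.universal (λ _ ()) (allSubsets n))))
size-⋃ᶠ {n} (i ∷ is) 𝒢 {k} bound = begin
  size (⋃ᶠ (i ∷ is) 𝒢)        ≤⟨ count-∨ (𝒢 i) (⋃ᶠ is 𝒢) (allSubsets n) ⟩
  size (𝒢 i) + size (⋃ᶠ is 𝒢) ≤⟨ +-mono-≤ (bound i (here refl))
                                           (size-⋃ᶠ is 𝒢 (λ j → bound j ∘ there)) ⟩
  k + length is * k            ∎
  where open ≤-Reasoning

∈-star⁺ : (ℱ : Family n) (T S : Subset n) → S ∈ᶠ ℱ → T ⊆ S → S ∈ᶠ star ℱ T
∈-star⁺ ℱ T S S∈ℱ T⊆S rewrite S∈ℱ with T ⊆? S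
... | yes _   = refl
... | no T⊈S = contradiction (λ {x} → T⊆S {x}) T⊈S

∈-star⁻ : (ℱ : Family n) (T S : Subset n) → S ∈ᶠ star ℱ T → S ∈ᶠ ℱ × T ⊆ S
∈-star⁻ ℱ T S S∈ with ℱ S | T ⊆? S
... | true | yes T⊆S = refl , T⊆S

size-star≤l : (ℱ : Family n) (T : Subset n) {t : ℕ} → ∣ T ∣ ≡ t → size (star ℱ T) ≤ l ℱ t
size-star≤l {n} ℱ T {t} ∣T∣≡t =
  ≤-foldr-⊔ (∈-map⁺ (λ T₀ → size (star ℱ T₀)) (∈-filter⁺ (λ S → ∣ S ∣ ≟ t) (∈-allSubsets T) ∣T∣≡t))

InL⇒size≡l : {𝒜 ℱ : Family n} {t : ℕ} → InL 𝒜 ℱ t → size 𝒜 ≡ l ℱ t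
InL⇒size≡l (_ , _ , 𝒜≗ℱ[T] , ∣ℱ[T]∣≡l) = trans (size-cong 𝒜≗ℱ[T]) ∣ℱ[T]∣≡l

_⊆⋂_ : Subset n → Family n → Set
T ⊆⋂ 𝒜 = ∀ S → S ∈ᶠ 𝒜 → T ⊆ S

IsNontrivial : ℕ → Family n → Set
IsNontrivial t 𝒜 = ∀ T → ∣ T ∣ ≡ t → ∃ λ B → B ∈ᶠ 𝒜 × ¬ T ⊆ B

⊆⋂-or-⊈ : (T : Subset n) (𝒜 : Family n) → T ⊆⋂ 𝒜 ⊎ ∃ λ B → B ∈ᶠ 𝒜 × ¬ T ⊆ B
⊆⋂-or-⊈ T 𝒜 with searchˢ (λ B → (𝒜 B Bool.≟ true) ×-dec ¬? (T ⊆? B))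
... | inj₂ T⊈B = inj₂ T⊈B
... | inj₁ none = inj₁ λ S S∈𝒜 {x} → decidable-stable (T ⊆? S) (λ T⊈S → none S (S∈𝒜 , T⊈S))

kernel-or-nontrivial : (𝒜 : Family n) (t : ℕ) → (∃ λ T → ∣ T ∣ ≡ t × T ⊆⋂ 𝒜) ⊎ IsNontrivial t 𝒜
kernel-or-nontrivial 𝒜 t with searchˢ (λ T → (∣ T ∣ ≟ t) ×-dec ⊆⋂? T)
  where
  ⊆⋂? : ∀ T → Dec (T ⊆⋂ 𝒜)
  ⊆⋂? T with ⊆⋂-or-⊈ T 𝒜
  ... | inj₁ T⊆⋂𝒜            = yes T⊆⋂𝒜
  ... | inj₂ (B , B∈𝒜 , T⊈B) = no λ T⊆⋂𝒜 → T⊈B (T⊆⋂𝒜 B B∈𝒜)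
... | inj₂ kernel = inj₁ kernel
... | inj₁ none   = inj₂ escape
  where
  escape : IsNontrivial _ 𝒜
  escape T ∣T∣≡t with ⊆⋂-or-⊈ T 𝒜
  ... | inj₁ T⊆⋂𝒜 = ⊥-elim (none T (∣T∣≡t , T⊆⋂𝒜))
  ... | inj₂ T⊈B  = T⊈B

⊆⋂⇒size≤l : {ℱ 𝒜 : Family n} {T : Subset n} {t : ℕ} → 𝒜 ⊆ᶠ ℱ → ∣ T ∣ ≡ t → T ⊆⋂ 𝒜 →
            (size 𝒜 ≤ l ℱ t) × (size 𝒜 ≡ l ℱ t → InL 𝒜 ℱ t)
⊆⋂⇒size≤l {ℱ = ℱ} {𝒜} {T} {t} 𝒜⊆ℱ ∣T∣≡t T⊆⋂𝒜 = ≤-trans 𝒜≤ℱ[T] ℱ[T]≤l , ≡l⇒InL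
  where
  𝒜⊆ℱ[T] : 𝒜 ⊆ᶠ star ℱ T
  𝒜⊆ℱ[T] S S∈𝒜 = ∈-star⁺ ℱ T S (𝒜⊆ℱ S S∈𝒜) (T⊆⋂𝒜 S S∈𝒜)
  𝒜≤ℱ[T] : size 𝒜 ≤ size (star ℱ T)
  𝒜≤ℱ[T] = size-mono 𝒜⊆ℱ[T]
  ℱ[T]≤l : size (star ℱ T) ≤ l ℱ t
  ℱ[T]≤l = size-star≤l ℱ T ∣T∣≡t
  ≡l⇒InL : size 𝒜 ≡ l ℱ t → InL 𝒜 ℱ t
  ≡l⇒InL 𝒜≡l = T , ∣T∣≡t , ⊆ᶠ∧size≥⇒≗ 𝒜⊆ℱ[T] (≤-trans ℱ[T]≤l (≤-reflexive (sym 𝒜≡l)))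
                         , ≤-antisym ℱ[T]≤l (≤-trans (≤-reflexive (sym 𝒜≡l)) 𝒜≤ℱ[T])

⊈-escape : (S : Subset n) {B T : Subset n} → ∣ T ∣ ≤ ∣ S ∩ B ∣ → ¬ T ⊆ B → ∃ λ x → x ∈ S ∩ B × x ∉ T
⊈-escape S {B} {T} ∣T∣≤∣S∩B∣ T⊈B = p⊈q⇒∃∈∉ S∩B⊈T
  where
  S∩B⊈T : ¬ S ∩ B ⊆ T
  S∩B⊈T S∩B⊆T = <⇒≱ (≤-<-trans (p⊆q⇒∣p∣≤∣q∣ S∩B⊆T∩B) (p⊈q⇒∣p∩q∣<∣p∣ T⊈B)) ∣T∣≤∣S∩B∣
    where
    S∩B⊆T∩B : S ∩ B ⊆ T ∩ B
    S∩B⊆T∩B x∈ = x∈p∩q⁺ (S∩B⊆T x∈ , proj₂ (x∈p∩q⁻ S B x∈))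

module _ {n r t : ℕ} {ℱ 𝒜 : Family n}
         (ℱ≤r : IsLeFamily r ℱ) (𝒜⊆ℱ : 𝒜 ⊆ᶠ ℱ) (𝒜-int : IsIntersecting t 𝒜) where

  size-star≤r*l : ∀ {T B} → ∣ T ∣ ≡ t → B ∈ᶠ 𝒜 → ¬ T ⊆ B → size (star 𝒜 T) ≤ r * l ℱ (suc t)
  size-star≤r*l {T} {B} ∣T∣≡t B∈𝒜 T⊈B = begin
    size (star 𝒜 T)          ≤⟨ size-mono cover ⟩
    size (⋃ᶠ xs 𝒢)           ≤⟨ size-⋃ᶠ xs 𝒢 bound ⟩
    length xs * l ℱ (suc t)  ≤⟨ *-monoˡ-≤ (l ℱ (suc t)) length-xs≤r ⟩
    r * l ℱ (suc t)          ∎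
    where
    open ≤-Reasoning
    xs : List (Fin n)
    xs = filter (λ x → ¬? (x ∈? T)) (elements B)
    𝒢 : Fin n → Family n
    𝒢 x = star ℱ (T ∪ ⁅ x ⁆)
    cover : star 𝒜 T ⊆ᶠ ⋃ᶠ xs 𝒢
    cover S S∈𝒜[T] with ∈-star⁻ 𝒜 T S S∈𝒜[T]
    ... | S∈𝒜 , T⊆S with ⊈-escape S (subst (_≤ ∣ S ∩ B ∣) (sym ∣T∣≡t) (𝒜-int S B S∈𝒜 B∈𝒜)) T⊈B
    ... | x , x∈S∩B , x∉T =
      ∈-⋃ᶠ 𝒢 (∈-filter⁺ (λ x → ¬? (x ∈? T)) (∈-elements B (proj₂ (x∈p∩q⁻ S B x∈S∩B))) x∉T)
             (∈-star⁺ ℱ (T ∪ ⁅ x ⁆) S (𝒜⊆ℱ S S∈𝒜) (p∪⁅x⁆⊆q T⊆S (proj₁ (x∈p∩q⁻ S B x∈S∩B))))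
    bound : ∀ x → x ∈ˡ xs → size (𝒢 x) ≤ l ℱ (suc t)
    bound x x∈xs = size-star≤l ℱ (T ∪ ⁅ x ⁆) (trans (∣p∪⁅x⁆∣≡1+∣p∣ T x∉T) (cong suc ∣T∣≡t))
      where x∉T = proj₂ (∈-filter⁻ (λ x → ¬? (x ∈? T)) {xs = elements B} x∈xs)
    length-xs≤r : length xs ≤ r
    length-xs≤r = begin
      length xs           ≤⟨ length-filter (λ x → ¬? (x ∈? T)) (elements B) ⟩
      length (elements B) ≡⟨ length-elements B ⟩
      ∣ B ∣               ≤⟨ ℱ≤r B (𝒜⊆ℱ B B∈𝒜) ⟩
      r                   ∎

  nontrivial⇒size≤ : IsNontrivial t 𝒜 → ∀ {A₁} → A₁ ∈ᶠ 𝒜 → size 𝒜 ≤ (r * (r C t)) * l ℱ (suc t)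
  nontrivial⇒size≤ nontrivial {A₁} A₁∈𝒜 = begin
    size 𝒜                        ≤⟨ size-mono cover ⟩
    size (⋃ᶠ Ts (star 𝒜))         ≤⟨ size-⋃ᶠ Ts (star 𝒜) bound ⟩
    length Ts * (r * l ℱ (suc t)) ≤⟨ *-monoˡ-≤ (r * l ℱ (suc t)) length-Ts≤rCt ⟩
    (r C t) * (r * l ℱ (suc t))   ≡⟨ *-assoc (r C t) r (l ℱ (suc t)) ⟨
    (r C t) * r * l ℱ (suc t)     ≡⟨ cong (_* l ℱ (suc t)) (*-comm (r C t) r) ⟩
    r * (r C t) * l ℱ (suc t)     ∎
    where
    open ≤-Reasoning
    Ts : List (Subset n)
    Ts = subsetsOfSize A₁ t
    cover : 𝒜 ⊆ᶠ ⋃ᶠ Ts (star 𝒜)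
    cover F F∈𝒜 with ∃-subsetOfSize (A₁ ∩ F) t (𝒜-int A₁ F A₁∈𝒜 F∈𝒜)
    ... | T , T⊆A₁∩F , ∣T∣≡t =
      ∈-⋃ᶠ (star 𝒜) (∈-subsetsOfSize (λ x∈T → proj₁ (x∈p∩q⁻ A₁ F (T⊆A₁∩F x∈T))) ∣T∣≡t)
                    (∈-star⁺ 𝒜 T F F∈𝒜 (λ x∈T → proj₂ (x∈p∩q⁻ A₁ F (T⊆A₁∩F x∈T))))
    bound : ∀ T → T ∈ˡ Ts → size (star 𝒜 T) ≤ r * l ℱ (suc t)
    bound T T∈Ts with All.lookup (∣∣≡-subsetsOfSize A₁ t) T∈Ts
    ... | ∣T∣≡t with nontrivial T ∣T∣≡t
    ... | B , B∈𝒜 , T⊈B = size-star≤r*l ∣T∣≡t B∈𝒜 T⊈B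
    length-Ts≤rCt : length Ts ≤ r C t
    length-Ts≤rCt = begin
      length Ts   ≡⟨ length-subsetsOfSize A₁ t ⟩
      ∣ A₁ ∣ C t  ≤⟨ C-monoˡ t (ℱ≤r A₁ (𝒜⊆ℱ A₁ A₁∈𝒜)) ⟩
      r C t       ∎

  nontrivial⇒size<l : t ≤ n → IsNontrivial t 𝒜 → c r r t * l ℱ (suc t) ≤ l ℱ t → size 𝒜 < l ℱ t
  nontrivial⇒size<l t≤n nontrivial c*l₊≤l with ∃-subsetOfSize ⊤ t (subst (t ≤_) (sym (∣⊤∣≡n n)) t≤n)
  ... | T₀ , _ , ∣T₀∣≡t with nontrivial T₀ ∣T₀∣≡t
  ... | A₁ , A₁∈𝒜 , _ =
    <-≤-trans (0<m≤k*l⇒m<[k+1]*l (r * (r C t)) (l ℱ (suc t))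
                                  (size-pos 𝒜 A₁ A₁∈𝒜) (nontrivial⇒size≤ nontrivial A₁∈𝒜))
              c*l₊≤l

theorem1p4 : (n r t : ℕ) → 1 ≤ t → t ≤ r → t ≤ n →
    (ℱ 𝒜 : Family n) → IsLeFamily r ℱ → 𝒜 ⊆ᶠ ℱ → IsIntersecting t 𝒜 →
    c r r t * l ℱ (suc t) ≤ l ℱ t →
    (size 𝒜 ≤ l ℱ t) × ((size 𝒜 ≡ l ℱ t) ⇔ InL 𝒜 ℱ t)
theorem1p4 n r t _ _ t≤n ℱ 𝒜 ℱ≤r 𝒜⊆ℱ 𝒜-int c*l₊≤l with kernel-or-nontrivial 𝒜 t
... | inj₁ (T , ∣T∣≡t , T⊆⋂𝒜) =
  let size≤l , ≡l⇒InL = ⊆⋂⇒size≤l 𝒜⊆ℱ ∣T∣≡t T⊆⋂𝒜 in size≤l , mk⇔ ≡l⇒InL InL⇒size≡l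
... | inj₂ nontrivial = <⇒≤ size<l , mk⇔ (λ size≡l → contradiction size≡l (<⇒≢ size<l)) InL⇒size≡l
  where
  size<l : size 𝒜 < l ℱ t
  size<l = nontrivial⇒size<l ℱ≤r 𝒜⊆ℱ 𝒜-int t≤n nontrivial c*l₊≤l
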